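{- Fix $m\ge 1$ and let $\{a_n\}_{n\ge0}$ be the $m$-gonal sequence. Every positive integer can be written uniquely as a sum of distinct terms of the $m$-gonal sequence in which no two summands lie in the same bin.
   Context: For an increasing sequence of positive integers $\{a_n\}_{n=0}^\infty$, the bins are $b_0=[a_0]$ and, for $k\ge1$, $b_k=[a_{m(k-1)+1},\dots,a_{mk}]$. A legal $m$-gonal decomposition of $z$ is $z=a_{\ell_t}+\cdots+a_{\ell_1}$ with $\ell_1<\cdots<\ell_t$ and no two summands in the same bin. The $m$-gonal sequence is defined recursively: each $a_i$ ($i\ge 0$) is the smallest positive integer that has no legal $m$-gonal decomposition using only $a_0,\dots,a_{i-1}$. -}

module Defs where

open import Data.Nat using (ℕ; zero; suc; _+_; _∸_; _<_; NonZero)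
open import Data.Nat.DivMod using (_/_)
open import Data.List using (List; map)
open import Data.Nat.ListAction using (sum)
open import Data.List.Relation.Unary.All using (All)
open import Data.List.Relation.Unary.AllPairs using (AllPairs)
open import Data.Product using (Σ; _×_)
open import Relation.Binary.PropositionalEquality using (_≡_; _≢_)
open import Relation.Nullary using (¬_)

-- Bin index of position i (m ≥ 1):  b_0 = [a_0], and for k ≥ 1,
-- b_k = [a_{m(k-1)+1}, …, a_{mk}].  So bin i = ⌈ i / m ⌉ = (i + m - 1) / m.
bin : (m : ℕ) → .{{NonZero m}} → ℕ → ℕ
bin m i = (i + m ∸ 1) / m

Legal : (m : ℕ) → .{{NonZero m}} → List ℕ → Set
Legal m ℓs = AllPairs _<_ ℓs × AllPairs (λ i j → bin m i ≢ bin m j) ℓs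

value : (ℕ → ℕ) → List ℕ → ℕ
value a ℓs = sum (map a ℓs)

HasLegalDecompBelow : (m : ℕ) → .{{NonZero m}} → (ℕ → ℕ) → ℕ → ℕ → Set
HasLegalDecompBelow m a i z =
  Σ (List ℕ) λ ℓs → Legal m ℓs × All (_< i) ℓs × value a ℓs ≡ z

IsMGonal : (m : ℕ) → .{{NonZero m}} → (ℕ → ℕ) → Set
IsMGonal m a = (i : ℕ) →
    0 < a i
  × ¬ HasLegalDecompBelow m a i (a i)
  × ((y : ℕ) → 0 < y → y < a i → HasLegalDecompBelow m a i y)

module Submission where

-- Write s(i) for the first index of the bin containing i.  The whole
-- argument rests on the growth inequality
--     a(i+1) ≥ a(i) + a(s(i)),
-- which holds because every y < a(i) + a(s(i)) already has a legal
-- decomposition below i+1: either y < a(i), or y - a(i) < a(s(i)) has one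
-- using indices below s(i), and appending i keeps it legal.  By strong
-- induction, a legal decomposition using indices below i then has value
-- less than a(i) (peel off the top index i; the rest lies below s(i)).
-- Uniqueness follows by induction on an index bound: two decompositions
-- with the same value either both use the top index (cancel it) or both
-- avoid it (the other case contradicts the value bound).  Existence is the
-- defining property of the sequence, since z < a(z).

open import Defs
open import Data.Nat using (ℕ; zero; suc; _+_; _∸_; _<_; _≤_; z≤n; s≤s; NonZero)
open import Data.Nat.Properties
open import Data.Nat.DivMod using (/-monoˡ-≤)
open import Data.Nat.Induction using (<-rec)
open import Data.List using (List; []; _∷_; _++_; [_])
open import Data.List.Relation.Unary.All using (All; []; _∷_)
import Data.List.Relation.Unary.All as All
import Data.List.Relation.Unary.All.Properties as All
open import Data.List.Relation.Unary.AllPairs using (AllPairs; []; _∷_)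
import Data.List.Relation.Unary.AllPairs.Properties as AllPairs
open import Data.Product using (Σ; _×_; _,_; proj₁; proj₂)
open import Data.Sum using (_⊎_; inj₁; inj₂)
open import Data.Empty using (⊥-elim)
open import Relation.Nullary using (yes; no)
open import Relation.Binary.PropositionalEquality hiding ([_])

module _ {A : Set} {R : A → A → Set} where

  AllPairs-++⁻ˡ : ∀ xs {ys} → AllPairs R (xs ++ ys) → AllPairs R xs
  AllPairs-++⁻ˡ []       _          = []
  AllPairs-++⁻ˡ (x ∷ xs) (px ∷ pxs) = All.++⁻ˡ xs px ∷ AllPairs-++⁻ˡ xs pxs

  AllPairs-++⁻ʳ : ∀ xs {ys} → AllPairs R (xs ++ ys) → All (λ x → All (R x) ys) xs
  AllPairs-++⁻ʳ []       _          = []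
  AllPairs-++⁻ʳ (x ∷ xs) (px ∷ pxs) = All.++⁻ʳ xs px ∷ AllPairs-++⁻ʳ xs pxs

value-snoc : (a : ℕ → ℕ) (r : List ℕ) (i : ℕ) → value a (r ++ [ i ]) ≡ value a r + a i
value-snoc a []      i = +-identityʳ (a i)
value-snoc a (x ∷ r) i = begin
  a x + value a (r ++ [ i ])  ≡⟨ cong (a x +_) (value-snoc a r i) ⟩
  a x + (value a r + a i)     ≡⟨ +-assoc (a x) (value a r) (a i) ⟨
  a x + value a r + a i       ∎
  where open ≡-Reasoning

top≤value-snoc : (a : ℕ → ℕ) (r : List ℕ) (i : ℕ) → a i ≤ value a (r ++ [ i ])
top≤value-snoc a r i = subst (a i ≤_) (sym (value-snoc a r i)) (m≤n+m (a i) (value a r))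

summand≤value : (a : ℕ → ℕ) (ℓs : List ℕ) → All (λ j → a j ≤ value a ℓs) ℓs
summand≤value a []       = []
summand≤value a (x ∷ xs) =
  m≤m+n (a x) (value a xs)
  ∷ All.map (λ p → ≤-trans p (m≤n+m (value a xs) (a x))) (summand≤value a xs)

All<-weaken : ∀ {k k′} {xs : List ℕ} → k ≤ k′ → All (_< k) xs → All (_< k′) xs
All<-weaken k≤k′ = All.map (λ p → <-≤-trans p k≤k′)

peel-top : ∀ i ℓs → AllPairs _<_ ℓs → All (_< suc i) ℓs →
  All (_< i) ℓs ⊎ Σ (List ℕ) λ r → ℓs ≡ r ++ [ i ] × All (_< i) r
peel-top i []       _          _          = inj₁ []
peel-top i (x ∷ xs) (x<xs ∷ inc) (x<1+i ∷ xs<1+i) with m<1+n⇒m<n∨m≡n x<1+i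
... | inj₂ refl = inj₂ ([] , cong (x ∷_) (nothing-above xs x<xs xs<1+i) , [])
  where
  nothing-above : ∀ ys → All (x <_) ys → All (_< suc x) ys → ys ≡ []
  nothing-above []       _         _         = refl
  nothing-above (y ∷ ys) (x<y ∷ _) (y≤x ∷ _) = ⊥-elim (<⇒≱ x<y (≤-pred y≤x))
... | inj₁ x<i with peel-top i xs inc xs<1+i
...   | inj₁ xs<i              = inj₁ (x<i ∷ xs<i)
...   | inj₂ (r , refl , r<i) = inj₂ (x ∷ r , refl , x<i ∷ r<i)

-- Blocks of a monotone labelling f of ℕ: blockStart i is the least index
-- carrying the same label as i.  Bins are the blocks of f = bin m.
module Blocks (f : ℕ → ℕ) (f-mono : ∀ {j k} → j ≤ k → f j ≤ f k) where

  blockStart : ℕ → ℕ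
  blockStart zero = 0
  blockStart (suc i) with f i ≟ f (suc i)
  ... | yes _ = blockStart i
  ... | no  _ = suc i

  blockStart-≤ : ∀ i → blockStart i ≤ i
  blockStart-≤ zero = z≤n
  blockStart-≤ (suc i) with f i ≟ f (suc i)
  ... | yes _ = m≤n⇒m≤1+n (blockStart-≤ i)
  ... | no  _ = ≤-refl

  before-block : ∀ i j → j < blockStart i → f j < f i
  before-block (suc i) j j<start with f i ≟ f (suc i)
  ... | yes fi≡ = subst (f j <_) fi≡ (before-block i j j<start)
  ... | no  fi≢ = ≤-<-trans (f-mono (≤-pred j<start)) (≤∧≢⇒< (f-mono (n≤1+n i)) fi≢)

  in-block : ∀ i j → blockStart i ≤ j → j ≤ i → f j ≡ f i
  in-block zero    j z≤n z≤n = refl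
  in-block (suc i) j start≤j j≤1+i with f i ≟ f (suc i)
  ... | no  _   = cong f (≤-antisym j≤1+i start≤j)
  ... | yes fi≡ with m≤n⇒m<n∨m≡n j≤1+i
  ...   | inj₁ j<1+i = trans (in-block i j start≤j (≤-pred j<1+i)) fi≡
  ...   | inj₂ refl  = refl

bin-mono : (m : ℕ) .{{_ : NonZero m}} → ∀ {j k} → j ≤ k → bin m j ≤ bin m k
bin-mono m j≤k = /-monoˡ-≤ m (∸-monoˡ-≤ 1 (+-monoˡ-≤ m j≤k))

module Bins (m : ℕ) .{{_ : NonZero m}} where

  open Blocks (bin m) (bin-mono m) public

  legal-snoc : ∀ i r → Legal m r → All (_< blockStart i) r → Legal m (r ++ [ i ])
  legal-snoc i r (inc , sep) r<start =
    AllPairs.++⁺ inc ([] ∷ []) (All.map (λ p → <-≤-trans p (blockStart-≤ i) ∷ []) r<start) ,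
    AllPairs.++⁺ sep ([] ∷ [])
      (All.map (λ {j} p → <⇒≢ (before-block i j p) ∷ []) r<start)

  legal-snoc⁻ : ∀ i r → Legal m (r ++ [ i ]) → All (_< i) r →
                Legal m r × All (_< blockStart i) r
  legal-snoc⁻ i r (inc , sep) r<i =
    (AllPairs-++⁻ˡ r inc , AllPairs-++⁻ˡ r sep) , before r r<i (AllPairs-++⁻ʳ r sep)
    where
    before : ∀ r → All (_< i) r → All (λ j → All (λ k → bin m j ≢ bin m k) [ i ]) r →
             All (_< blockStart i) r
    before []      _            _                  = []
    before (j ∷ r) (j<i ∷ r<i) ((bin≢ ∷ []) ∷ seps) with j <? blockStart i
    ... | yes j<start = j<start ∷ before r r<i seps
    ... | no  j≮start = ⊥-elim (bin≢ (in-block i j (≮⇒≥ j≮start) (<⇒≤ j<i)))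

module MGonal (m : ℕ) .{{_ : NonZero m}} (a : ℕ → ℕ) (isMGonal : IsMGonal m a) where

  open Bins m

  Decomp : ℕ → ℕ → Set
  Decomp = HasLegalDecompBelow m a

  a-pos : ∀ i → 0 < a i
  a-pos i = proj₁ (isMGonal i)

  Decomp-mono : ∀ {k k′ z} → k ≤ k′ → Decomp k z → Decomp k′ z
  Decomp-mono k≤k′ (ℓs , legal , ℓs<k , val) = ℓs , legal , All<-weaken k≤k′ ℓs<k , val

  Decomp-below : ∀ k z → z < a k → Decomp k z
  Decomp-below k zero    _     = [] , ([] , []) , [] , refl
  Decomp-below k (suc z) z<ak = proj₂ (proj₂ (isMGonal k)) (suc z) (s≤s z≤n) z<ak

  -- Every y < a i + a (blockStart i) decomposes with indices below i + 1:
  -- either y < a i, or y ∸ a i < a (blockStart i) decomposes before the bin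
  -- of i and the summand a i can be appended.
  Decomp-step : ∀ i y → y < a i + a (blockStart i) → Decomp (suc i) y
  Decomp-step i y y< with y <? a i
  ... | yes y<ai = Decomp-mono (n≤1+n i) (Decomp-below i y y<ai)
  ... | no  y≮ai = append-top (Decomp-below (blockStart i) (y ∸ a i) rest<)
    where
    ai≤y : a i ≤ y
    ai≤y = ≮⇒≥ y≮ai

    rest< : y ∸ a i < a (blockStart i)
    rest< = +-cancelˡ-< (a i) (y ∸ a i) (a (blockStart i))
              (subst (_< a i + a (blockStart i)) (sym (m+[n∸m]≡n ai≤y)) y<)

    append-top : Decomp (blockStart i) (y ∸ a i) → Decomp (suc i) y
    append-top (r , legal , r<start , val) =
      r ++ [ i ] ,
      legal-snoc i r legal r<start ,
      All.++⁺ (All<-weaken (m≤n⇒m≤1+n (blockStart-≤ i)) r<start) (≤-refl ∷ []) ,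
      trans (value-snoc a r i) (trans (cong (_+ a i) val) (m∸n+n≡m ai≤y))

  growth : ∀ i → a i + a (blockStart i) ≤ a (suc i)
  growth i = ≮⇒≥ λ lt → proj₁ (proj₂ (isMGonal (suc i))) (Decomp-step i (a (suc i)) lt)

  a-increasing : ∀ i → a i < a (suc i)
  a-increasing i = <-≤-trans (m<m+n (a i) (a-pos (blockStart i))) (growth i)

  index<a : ∀ i → i < a i
  index<a zero    = a-pos zero
  index<a (suc i) = <-≤-trans (s≤s (index<a i)) (a-increasing i)

  value<a : ∀ i ℓs → Legal m ℓs → All (_< i) ℓs → value a ℓs < a i
  value<a = <-rec _ step
    where
    step : ∀ i → (∀ {j} → j < i → ∀ ℓs → Legal m ℓs → All (_< j) ℓs → value a ℓs < a j) →
           ∀ ℓs → Legal m ℓs → All (_< i) ℓs → value a ℓs < a i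
    step zero    _  []      _ _        = a-pos zero
    step zero    _  (_ ∷ _) _ (() ∷ _)
    step (suc i) IH ℓs legal ℓs<1+i with peel-top i ℓs (proj₁ legal) ℓs<1+i
    ... | inj₁ ℓs<i = <-trans (IH ≤-refl ℓs legal ℓs<i) (a-increasing i)
    ... | inj₂ (r , refl , r<i) with legal-snoc⁻ i r legal r<i
    ...   | legal-r , r<start = begin-strict
      value a (r ++ [ i ])  ≡⟨ value-snoc a r i ⟩
      value a r + a i       <⟨ +-monoˡ-< (a i) (IH (s≤s (blockStart-≤ i)) r legal-r r<start) ⟩
      a (blockStart i) + a i ≡⟨ +-comm (a (blockStart i)) (a i) ⟩
      a i + a (blockStart i) ≤⟨ growth i ⟩
      a (suc i)             ∎
      where open ≤-Reasoning

  unique-below : ∀ i ℓs ℓs′ → Legal m ℓs → Legal m ℓs′ → All (_< i) ℓs → All (_< i) ℓs′ →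
                 value a ℓs ≡ value a ℓs′ → ℓs ≡ ℓs′
  unique-below zero [] [] _ _ _ _ _ = refl
  unique-below zero (_ ∷ _) _ _ _ (() ∷ _) _ _
  unique-below zero [] (_ ∷ _) _ _ _ (() ∷ _) _
  unique-below (suc i) ℓs ℓs′ legal legal′ ℓs<1+i ℓs′<1+i val
    with peel-top i ℓs (proj₁ legal) ℓs<1+i | peel-top i ℓs′ (proj₁ legal′) ℓs′<1+i
  ... | inj₁ ℓs<i | inj₁ ℓs′<i = unique-below i ℓs ℓs′ legal legal′ ℓs<i ℓs′<i val
  ... | inj₂ (r , refl , r<i) | inj₂ (r′ , refl , r′<i) =
    cong (_++ [ i ]) (unique-below i r r′ (proj₁ (legal-snoc⁻ i r legal r<i))
                                         (proj₁ (legal-snoc⁻ i r′ legal′ r′<i)) r<i r′<i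
      (+-cancelʳ-≡ (a i) (value a r) (value a r′)
        (trans (sym (value-snoc a r i)) (trans val (value-snoc a r′ i)))))
  ... | inj₁ ℓs<i | inj₂ (r′ , refl , _) =
    ⊥-elim (<⇒≱ (value<a i ℓs legal ℓs<i) (subst (a i ≤_) (sym val) (top≤value-snoc a r′ i)))
  ... | inj₂ (r , refl , _) | inj₁ ℓs′<i =
    ⊥-elim (<⇒≱ (value<a i ℓs′ legal′ ℓs′<i) (subst (a i ≤_) val (top≤value-snoc a r i)))

  -- A decomposition of z only uses indices below z, since j < a j.
  indices<value : ∀ z ℓs → value a ℓs ≡ z → All (_< z) ℓs
  indices<value z ℓs val =
    All.map (λ {j} aj≤ → <-≤-trans (index<a j) (subst (a j ≤_) val aj≤)) (summand≤value a ℓs)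

  unique : ∀ z ℓs ℓs′ → Legal m ℓs → Legal m ℓs′ → value a ℓs ≡ z → value a ℓs′ ≡ z → ℓs ≡ ℓs′
  unique z ℓs ℓs′ legal legal′ val val′ =
    unique-below z ℓs ℓs′ legal legal′ (indices<value z ℓs val) (indices<value z ℓs′ val′)
      (trans val (sym val′))

-- Existence: z < a z, so z decomposes by minimality of a z; uniqueness as above.
theorem1p5 : (m : ℕ) → .{{_ : NonZero m}} → (a : ℕ → ℕ) → IsMGonal m a →
    (z : ℕ) → 0 < z →
      Σ (List ℕ) λ ℓs → Legal m ℓs × value a ℓs ≡ z
        × ((ℓs′ : List ℕ) → Legal m ℓs′ → value a ℓs′ ≡ z → ℓs′ ≡ ℓs)
theorem1p5 m a isMGonal z _ with MGonal.Decomp-below m a isMGonal z z (MGonal.index<a m a isMGonal z)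
... | ℓs , legal , _ , val =
  ℓs , legal , val , λ ℓs′ legal′ val′ → MGonal.unique m a isMGonal z ℓs′ ℓs legal′ legal val′ val
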